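{- Let $L$ be a finite set with $|L|\geq 3$ and let $R$ be a strictly dense set of rooted triples on $L$. Then $R$ is consistent if and only if $\operatorname{cl}(R')\subseteq R$ holds for every subset $R'\subseteq R$ with $|R'|=2$.
   Context: A phylogenetic tree on a finite set $L$ is a rooted tree with leaf set $L$ in which no inner vertex has outdegree one (and the root has indegree zero). For vertices $u,v$ write $u\preceq_T v$ if $v$ lies on the path from $u$ to the root, and $u\prec_T v$ if moreover $u\neq v$; $\operatorname{lca}_T$ denotes the most recent common ancestor. A rooted triple $(xy|z)$ (with $(xy|z)=(yx|z)$) is the rooted binary tree on three distinct leaves $x,y,z$ in which $x,y$ form a cherry; its leaf set is $L_r=\{x,y,z\}$. A phylogenetic tree $T$ on $L$ displays $(xy|z)$ if $x,y,z\in L$ and $\operatorname{lca}_T(x,y)\prec_T\operatorname{lca}_T(x,y,z)$; $\mathfrak{R}(T)$ is the set of all triples displayed by $T$. For a set $R$ of triples let $L_R=\bigcup_{r\in R}L_r$. $R$ is consistent if some phylogenetic tree on $L_R$ displays all triples of $R$. $R$ is strictly dense on $L$ if for every 3-element subset $\{x,y,z\}\subseteq L$ there is exactly one triple $r\in R$ with $L_r=\{x,y,z\}$ (and all triples of $R$ have leaves in $L$). For a consistent set $R$, its closure is $\operatorname{cl}(R)=\bigcap_{T}\mathfrak{R}(T)$, the intersection over all phylogenetic trees $T$ on $L_R$ displaying $R$. (Any two-element subset of a consistent set is consistent, so $\operatorname{cl}(R')$ is defined in the "if" direction whenever $R'$ is consistent; two distinct triples on the same three leaves are inconsistent and cannot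 both lie in a strictly dense set.) -}

module Defs where

open import Data.Nat using (ℕ; _≤_)
open import Data.Fin using (Fin)
open import Data.List using (List; []; length)
open import Data.List.Membership.Propositional using (_∈_)
open import Data.Product using (Σ; ∃; ∃-syntax; _×_; _,_)
open import Data.Sum using (_⊎_; inj₁; inj₂)
open import Data.Empty using (⊥)
open import Relation.Nullary using (¬_)
open import Relation.Binary.PropositionalEquality using (_≡_; _≢_; refl; sym)

-- Leaf set L is modelled as Fin n.

data Tree (n : ℕ) : Set where
  leaf : Fin n → Tree n
  node : List (Tree n) → Tree n

-- Vertices of a tree = positions (paths from the root).
data Pos {n : ℕ} : Tree n → Set where
  here  : ∀ {t} → Pos t
  there : ∀ {ts t} → t ∈ ts → Pos t → Pos (node ts)

sub : ∀ {n} {t : Tree n} → Pos t → Tree n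
sub {t = t} here = t
sub (there _ p) = sub p

-- u ⪯ v : v lies on the path from u to the root.
data _⪯_ {n : ℕ} : {t : Tree n} → Pos t → Pos t → Set where
  ⪯-root  : ∀ {t} {u : Pos t} → u ⪯ here
  ⪯-there : ∀ {ts t} {e : t ∈ ts} {u v : Pos t} →
            u ⪯ v → there e u ⪯ there e v

_≺_ : ∀ {n} {t : Tree n} → Pos t → Pos t → Set
u ≺ v = u ⪯ v × u ≢ v

IsLCA : ∀ {n} {t : Tree n} → (Pos t → Set) → Pos t → Set
IsLCA {t = t} A u =
  (∀ a → A a → a ⪯ u) × (∀ (w : Pos t) → (∀ a → A a → a ⪯ w) → u ⪯ w)

IsPhyloOn : ∀ {n} → (Fin n → Set) → Tree n → Set
IsPhyloOn {n} S T =
  (∀ (p : Pos T) ts → sub p ≡ node ts → length ts ≢ 1) ×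
  (∀ (p : Pos T) → sub p ≢ node []) ×
  (∀ x → S x → ∃[ p ] (sub {t = T} p ≡ leaf x)) ×
  (∀ (p : Pos T) x → sub p ≡ leaf x → S x) ×
  (∀ (p q : Pos T) x → sub p ≡ leaf x → sub q ≡ leaf x → p ≡ q)

record Triple (n : ℕ) : Set where
  constructor triple
  field
    x y z : Fin n
    x≢y : x ≢ y
    x≢z : x ≢ z
    y≢z : y ≢ z

open Triple public

-- (a b | c) denotes the same triple as r  (recall (xy|z) = (yx|z)).
SameRaw : ∀ {n} → Fin n → Fin n → Fin n → Triple n → Set
SameRaw a b c r = c ≡ z r × ((a ≡ x r × b ≡ y r) ⊎ (a ≡ y r × b ≡ x r))

_≈T_ : ∀ {n} → Triple n → Triple n → Set
t ≈T r = SameRaw (x t) (y t) (z t) r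

Displays : ∀ {n} → Tree n → Triple n → Set
Displays T t =
  Σ (Pos T) λ px → Σ (Pos T) λ py → Σ (Pos T) λ pz →
  sub px ≡ leaf (x t) × sub py ≡ leaf (y t) × sub pz ≡ leaf (z t) ×
  Σ (Pos T) λ u → Σ (Pos T) λ w →
    IsLCA (λ a → a ≡ px ⊎ a ≡ py) u ×
    IsLCA (λ a → a ≡ px ⊎ a ≡ py ⊎ a ≡ pz) w ×
    u ≺ w

-- Sets of rooted triples: mem a b c means (ab|c) ∈ R.

record TripleSet (n : ℕ) : Set₁ where
  field
    mem      : Fin n → Fin n → Fin n → Set
    mem-sym  : ∀ {a b c} → mem a b c → mem b a c
    mem-dist : ∀ {a b c} → mem a b c → a ≢ b × a ≢ c × b ≢ c

open TripleSet public

_∈R_ : ∀ {n} → Triple n → TripleSet n → Set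
t ∈R R = mem R (x t) (y t) (z t)

LeafSet : ∀ {n} → TripleSet n → Fin n → Set
LeafSet R a = ∃[ b ] ∃[ c ] (mem R a b c ⊎ mem R b a c ⊎ mem R b c a)

DisplaysAll : ∀ {n} → Tree n → TripleSet n → Set
DisplaysAll {n} T R = ∀ (t : Triple n) → t ∈R R → Displays T t

Consistent : ∀ {n} → TripleSet n → Set
Consistent R = ∃[ T ] (IsPhyloOn (LeafSet R) T × DisplaysAll T R)

Cl : ∀ {n} → TripleSet n → Triple n → Set
Cl R t = ∀ T → IsPhyloOn (LeafSet R) T → DisplaysAll T R → Displays T t

ExactlyOne : Set → Set → Set → Set
ExactlyOne A B C = (A ⊎ B ⊎ C) × ¬ (A × B) × ¬ (A × C) × ¬ (B × C)

StrictlyDense : ∀ {n} → TripleSet n → Set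
StrictlyDense {n} R = ∀ (a b c : Fin n) → a ≢ b → a ≢ c → b ≢ c →
  ExactlyOne (mem R a b c) (mem R a c b) (mem R b c a)

private
  same-sym : ∀ {n} {a b c : Fin n} {r} → SameRaw a b c r → SameRaw b a c r
  same-sym (e , inj₁ (p , q)) = e , inj₂ (q , p)
  same-sym (e , inj₂ (p , q)) = e , inj₁ (q , p)

  same-dist : ∀ {n} {a b c : Fin n} {r} → SameRaw a b c r →
              a ≢ b × a ≢ c × b ≢ c
  same-dist {r = triple x y z xy xz yz} (refl , inj₁ (refl , refl)) =
    xy , xz , yz
  same-dist {r = triple x y z xy xz yz} (refl , inj₂ (refl , refl)) =
    (λ e → xy (sym e)) , yz , xz

pair : ∀ {n} → Triple n → Triple n → TripleSet n
pair r₁ r₂ = record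
  { mem      = λ a b c → SameRaw a b c r₁ ⊎ SameRaw a b c r₂
  ; mem-sym  = msym
  ; mem-dist = mdist
  }
  where
  msym : ∀ {a b c} → SameRaw a b c r₁ ⊎ SameRaw a b c r₂ →
         SameRaw b a c r₁ ⊎ SameRaw b a c r₂
  msym (inj₁ s) = inj₁ (same-sym {r = r₁} s)
  msym (inj₂ s) = inj₂ (same-sym {r = r₂} s)
  mdist : ∀ {a b c} → SameRaw a b c r₁ ⊎ SameRaw a b c r₂ →
          a ≢ b × a ≢ c × b ≢ c
  mdist (inj₁ s) = same-dist {r = r₁} s
  mdist (inj₂ s) = same-dist {r = r₂} s

module Submission where

open import Defs
open import Data.Nat using (ℕ; suc; _+_; _≤_; s≤s)
open import Data.Fin using (Fin; zero; suc) renaming (_≟_ to _≟ᶠ_)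
open import Data.List using (List; []; _∷_; _++_; allFin; length)
open import Data.List.Relation.Unary.Any using (here; there)
import Data.List.Relation.Unary.Any as Any
open import Data.List.Membership.Propositional using (_∈_)
open import Data.List.Membership.Propositional.Properties using (∈-allFin; ∈-++⁺ˡ; ∈-++⁺ʳ; ∈-++⁻)
open import Data.Product using (Σ; ∃-syntax; _×_; _,_; proj₁; proj₂)
open import Data.Sum using (_⊎_; inj₁; inj₂)
import Data.Sum as Sum
open import Data.Unit using (⊤; tt)
open import Data.Empty using (⊥; ⊥-elim)
open import Relation.Nullary using (¬_; Dec; yes; no)
open import Relation.Binary.PropositionalEquality
open import Function.Base using (_∘_)
open import Function.Bundles using (_⇔_; mk⇔)

-- Both conditions are equivalent to R being closed under the four rules that derive a
-- triple from two (InferenceClosed). A phylogenetic tree displaying R displays every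
-- conclusion, and by strict density a triple displayed by a tree that displays R on its
-- leaves is the triple of R on those leaves; hence consistency, and likewise the closure
-- condition, imply closure under the rules. Conversely, for R closed under the rules a
-- binary tree displaying R on any set of leaves is built by inserting leaves one at a time:
-- at a vertex with subtrees P and Q, the triple of R on the new leaf a and leaves p ∈ P,
-- q ∈ Q decides whether a is grafted above the vertex (pq|a) or inserted into P (pa|q) or
-- into Q (qa|p), and the rules extend that triple to all leaves of P and Q. Built on all
-- of L the tree witnesses consistency; built on the leaves of r₁ and r₂ it displays
-- {r₁, r₂} and only triples of R, so cl({r₁, r₂}) ⊆ R.

-- Each conclusion lies in the closure of its two premises; the side conditions only make
-- its three leaves distinct.
record InferenceClosed {n : ℕ} (S : Fin n → Fin n → Fin n → Set) : Set where
  field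
    ab|c,ac|d⇒bc|d : ∀ {a b c d} → S a b c → S a c d → b ≢ d → S b c d
    ab|c,ac|d⇒ab|d : ∀ {a b c d} → S a b c → S a c d → b ≢ d → S a b d
    ab|c,cd|b⇒ab|d : ∀ {a b c d} → S a b c → S c d b → a ≢ d → S a b d
    ab|c,ad|c⇒bd|c : ∀ {a b c d} → S a b c → S a d c → b ≢ d → S b d c

module _ {n : ℕ} where

  ⪯-trans : {t : Tree n} {u v w : Pos t} → u ⪯ v → v ⪯ w → u ⪯ w
  ⪯-trans _ ⪯-root = ⪯-root
  ⪯-trans (⪯-there p) (⪯-there q) = ⪯-there (⪯-trans p q)

  ⪯-antisym : {t : Tree n} {u v : Pos t} → u ⪯ v → v ⪯ u → u ≡ v
  ⪯-antisym {u = here} ⪯-root ⪯-root = refl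
  ⪯-antisym (⪯-there p) (⪯-there q) = cong (there _) (⪯-antisym p q)

  ⪯-comparable : {t : Tree n} {u v w : Pos t} → u ⪯ v → u ⪯ w → v ⪯ w ⊎ w ⪯ v
  ⪯-comparable _ ⪯-root = inj₁ ⪯-root
  ⪯-comparable ⪯-root _ = inj₂ ⪯-root
  ⪯-comparable (⪯-there p) (⪯-there q) with ⪯-comparable p q
  ... | inj₁ v⪯w = inj₁ (⪯-there v⪯w)
  ... | inj₂ w⪯v = inj₂ (⪯-there w⪯v)

  child-≟ : {ts : List (Tree n)} {t₁ t₂ : Tree n} (e₁ : t₁ ∈ ts) (e₂ : t₂ ∈ ts) →
            Dec (_≡_ {A = Σ (Tree n) (_∈ ts)} (t₁ , e₁) (t₂ , e₂))
  child-≟ (here refl) (here refl) = yes refl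
  child-≟ (here _) (there _) = no λ ()
  child-≟ (there _) (here _) = no λ ()
  child-≟ (there e₁) (there e₂) with child-≟ e₁ e₂
  ... | yes refl = yes refl
  ... | no e₁≢e₂ = no λ { refl → e₁≢e₂ refl }

  lca : {t : Tree n} → Pos t → Pos t → Pos t
  lca here _ = here
  lca (there _ _) here = here
  lca (there e₁ p) (there e₂ q) with child-≟ e₁ e₂
  ... | yes refl = there e₁ (lca p q)
  ... | no _ = here

  lca-upperˡ : {t : Tree n} (p q : Pos t) → p ⪯ lca p q
  lca-upperˡ here _ = ⪯-root
  lca-upperˡ (there _ _) here = ⪯-root
  lca-upperˡ (there e₁ p) (there e₂ q) with child-≟ e₁ e₂
  ... | yes refl = ⪯-there (lca-upperˡ p q)
  ... | no _ = ⪯-root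

  lca-upperʳ : {t : Tree n} (p q : Pos t) → q ⪯ lca p q
  lca-upperʳ here _ = ⪯-root
  lca-upperʳ (there _ _) here = ⪯-root
  lca-upperʳ (there e₁ p) (there e₂ q) with child-≟ e₁ e₂
  ... | yes refl = ⪯-there (lca-upperʳ p q)
  ... | no _ = ⪯-root

  lca-least : {t : Tree n} {p q w : Pos t} → p ⪯ w → q ⪯ w → lca p q ⪯ w
  lca-least {w = here} _ _ = ⪯-root
  lca-least {p = there e p} {there .e q} {there .e w} (⪯-there p⪯w) (⪯-there q⪯w)
    with child-≟ e e
  ... | yes refl = ⪯-there (lca-least p⪯w q⪯w)
  ... | no e≢e = ⊥-elim (e≢e refl)

  Occurs : Tree n → Fin n → Set
  Occurs t a = Σ (Pos t) λ p → sub p ≡ leaf a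

  Below : {t : Tree n} → Pos t → Fin n → Set
  Below {t} v a = Σ (Pos t) λ p → p ⪯ v × sub p ≡ leaf a

  UniqueLabels : Tree n → Set
  UniqueLabels t = ∀ (p q : Pos t) a → sub p ≡ leaf a → sub q ≡ leaf a → p ≡ q

  IsPhyloOn⇒UniqueLabels : {S : Fin n → Set} {t : Tree n} → IsPhyloOn S t → UniqueLabels t
  IsPhyloOn⇒UniqueLabels (_ , _ , _ , _ , unique) = unique

  -- An lca-free form of displaying (ab|c), equivalent to it when labels are unique.
  Separates : Tree n → Fin n → Fin n → Fin n → Set
  Separates t a b c = Σ (Pos t) λ v → Below v a × Below v b × ¬ Below v c × Occurs t c

  Below-mono : {t : Tree n} {v w : Pos t} {a : Fin n} → Below v a → v ⪯ w → Below w a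
  Below-mono (p , p⪯v , leaf-p) v⪯w = p , ⪯-trans p⪯v v⪯w , leaf-p

  Below⇒Occurs : {t : Tree n} {v : Pos t} {a : Fin n} → Below v a → Occurs t a
  Below⇒Occurs (p , _ , leaf-p) = p , leaf-p

  Below-comparable : {t : Tree n} → UniqueLabels t → {v w : Pos t} {a : Fin n} →
                     Below v a → Below w a → v ⪯ w ⊎ w ⪯ v
  Below-comparable unique (p , p⪯v , leaf-p) (q , q⪯w , leaf-q)
    with unique p q _ leaf-p leaf-q
  ... | refl = ⪯-comparable p⪯v q⪯w

  Separates-sym : {t : Tree n} {a b c : Fin n} → Separates t a b c → Separates t b a c
  Separates-sym (v , a↓ , b↓ , rest) = v , b↓ , a↓ , rest

  Separates-≢ˡ : {t : Tree n} {a b c : Fin n} → Separates t a b c → a ≢ c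
  Separates-≢ˡ (_ , a↓ , _ , ¬c↓ , _) refl = ¬c↓ a↓

  Separates-≢ʳ : {t : Tree n} {a b c : Fin n} → Separates t a b c → b ≢ c
  Separates-≢ʳ (_ , _ , b↓ , ¬c↓ , _) refl = ¬c↓ b↓

  module _ {t : Tree n} (unique : UniqueLabels t) where

    Separates-excl : {a b c : Fin n} → Separates t a b c → ¬ Separates t a c b
    Separates-excl (v , a↓ , b↓ , ¬c↓ , _) (w , a↓′ , c↓ , ¬b↓ , _)
      with Below-comparable unique a↓ a↓′
    ... | inj₁ v⪯w = ¬b↓ (Below-mono b↓ v⪯w)
    ... | inj₂ w⪯v = ¬c↓ (Below-mono c↓ w⪯v)

    Separates-closed : InferenceClosed (Separates t)
    Separates-closed = record
      { ab|c,ac|d⇒bc|d = λ ab|c ac|d _ → infer-bc|d ab|c ac|d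
      ; ab|c,ac|d⇒ab|d = λ ab|c ac|d _ → infer-ab|d ab|c ac|d
      ; ab|c,cd|b⇒ab|d = λ ab|c cd|b _ → infer-ab|d′ ab|c cd|b
      ; ab|c,ad|c⇒bd|c = λ ab|c ad|c _ → infer-bd|c ab|c ad|c
      }
      where
      infer-bc|d : {a b c d : Fin n} → Separates t a b c → Separates t a c d → Separates t b c d
      infer-bc|d (v , a↓ , b↓ , ¬c↓ , _) (w , a↓′ , c↓ , ¬d↓ , d∈)
        with Below-comparable unique a↓ a↓′
      ... | inj₁ v⪯w = w , Below-mono b↓ v⪯w , c↓ , ¬d↓ , d∈
      ... | inj₂ w⪯v = ⊥-elim (¬c↓ (Below-mono c↓ w⪯v))

      infer-ab|d : {a b c d : Fin n} → Separates t a b c → Separates t a c d → Separates t a b d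
      infer-ab|d (v , a↓ , b↓ , ¬c↓ , _) (w , a↓′ , c↓ , ¬d↓ , d∈)
        with Below-comparable unique a↓ a↓′
      ... | inj₁ v⪯w = v , a↓ , b↓ , (λ d↓ → ¬d↓ (Below-mono d↓ v⪯w)) , d∈
      ... | inj₂ w⪯v = ⊥-elim (¬c↓ (Below-mono c↓ w⪯v))

      infer-ab|d′ : {a b c d : Fin n} → Separates t a b c → Separates t c d b → Separates t a b d
      infer-ab|d′ (v , a↓ , b↓ , ¬c↓ , _) (w , c↓ , d↓′ , ¬b↓ , _) =
        v , a↓ , b↓ , ¬d↓ , Below⇒Occurs d↓′
        where
        ¬d↓ : ¬ Below v _
        ¬d↓ d↓ with Below-comparable unique d↓ d↓′
        ... | inj₁ v⪯w = ¬b↓ (Below-mono b↓ v⪯w)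
        ... | inj₂ w⪯v = ¬c↓ (Below-mono c↓ w⪯v)

      infer-bd|c : {a b c d : Fin n} → Separates t a b c → Separates t a d c → Separates t b d c
      infer-bd|c (v , a↓ , b↓ , ¬c↓ , c∈) (w , a↓′ , d↓ , ¬c↓′ , c∈′)
        with Below-comparable unique a↓ a↓′
      ... | inj₁ v⪯w = w , Below-mono b↓ v⪯w , d↓ , ¬c↓′ , c∈′
      ... | inj₂ w⪯v = v , b↓ , Below-mono d↓ w⪯v , ¬c↓ , c∈

  Displays⇒Separates : {t : Tree n} → UniqueLabels t → (r : Triple n) → Displays t r →
                       Separates t (x r) (y r) (z r)
  Displays⇒Separates unique r
    (px , py , pz , leaf-x , leaf-y , leaf-z , u , w , (u-upper , _) , (_ , w-least) , u⪯w , u≢w) =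
    u , (px , u-upper px (inj₁ refl) , leaf-x) , (py , u-upper py (inj₂ refl) , leaf-y) ,
    ¬z↓ , (pz , leaf-z)
    where
    ¬z↓ : ¬ Below u (z r)
    ¬z↓ (q , q⪯u , leaf-q) with unique q pz _ leaf-q leaf-z
    ... | refl = u≢w (⪯-antisym u⪯w (w-least u below-u))
      where
      below-u : ∀ a → a ≡ px ⊎ a ≡ py ⊎ a ≡ q → a ⪯ u
      below-u _ (inj₁ refl) = u-upper px (inj₁ refl)
      below-u _ (inj₂ (inj₁ refl)) = u-upper py (inj₂ refl)
      below-u _ (inj₂ (inj₂ refl)) = q⪯u

  Separates⇒Displays : {t : Tree n} (r : Triple n) → Separates t (x r) (y r) (z r) → Displays t r
  Separates⇒Displays r (v , (px , px⪯v , leaf-x) , (py , py⪯v , leaf-y) , ¬z↓ , (pz , leaf-z)) =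
    px , py , pz , leaf-x , leaf-y , leaf-z , u , w ,
    (u-upper , λ _ ub → lca-least (ub px (inj₁ refl)) (ub py (inj₂ refl))) ,
    (w-upper , λ _ ub → lca-least (lca-least (ub px (inj₁ refl)) (ub py (inj₂ (inj₁ refl))))
                                  (ub pz (inj₂ (inj₂ refl)))) ,
    lca-upperˡ u pz , u≢w
    where
    u = lca px py
    w = lca u pz
    u-upper : ∀ a → a ≡ px ⊎ a ≡ py → a ⪯ u
    u-upper _ (inj₁ refl) = lca-upperˡ px py
    u-upper _ (inj₂ refl) = lca-upperʳ px py
    w-upper : ∀ a → a ≡ px ⊎ a ≡ py ⊎ a ≡ pz → a ⪯ w
    w-upper _ (inj₁ refl) = ⪯-trans (lca-upperˡ px py) (lca-upperˡ u pz)
    w-upper _ (inj₂ (inj₁ refl)) = ⪯-trans (lca-upperʳ px py) (lca-upperˡ u pz)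
    w-upper _ (inj₂ (inj₂ refl)) = lca-upperʳ u pz
    u≢w : u ≢ w
    u≢w u≡w = ¬z↓ (pz , ⪯-trans (subst (pz ⪯_) (sym u≡w) (lca-upperʳ u pz))
                                (lca-least px⪯v py⪯v) , leaf-z)

-- Binary trees

data BinTree (n : ℕ) : Set where
  tip : Fin n → BinTree n
  bin : BinTree n → BinTree n → BinTree n

module _ {n : ℕ} where

  pattern ↙ p = there (here refl) p
  pattern ↘ p = there (there (here refl)) p

  toTree : BinTree n → Tree n
  toTree (tip a) = leaf a
  toTree (bin l r) = node (toTree l ∷ toTree r ∷ [])

  infix 4 _∈ᴮ_ _∉ᴮ_ _∈ᴮ?_

  _∈ᴮ_ : Fin n → BinTree n → Set
  a ∈ᴮ tip b = a ≡ b
  a ∈ᴮ bin l r = a ∈ᴮ l ⊎ a ∈ᴮ r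

  _∉ᴮ_ : Fin n → BinTree n → Set
  a ∉ᴮ b = ¬ a ∈ᴮ b

  _∈ᴮ?_ : (a : Fin n) (b : BinTree n) → Dec (a ∈ᴮ b)
  a ∈ᴮ? tip b = a ≟ᶠ b
  a ∈ᴮ? bin l r with a ∈ᴮ? l | a ∈ᴮ? r
  ... | yes a∈l | _ = yes (inj₁ a∈l)
  ... | no _ | yes a∈r = yes (inj₂ a∈r)
  ... | no a∉l | no a∉r = no λ { (inj₁ a∈l) → a∉l a∈l ; (inj₂ a∈r) → a∉r a∈r }

  ∉ᴮ⇒≢ : {b : BinTree n} {a c : Fin n} → a ∉ᴮ b → c ∈ᴮ b → c ≢ a
  ∉ᴮ⇒≢ a∉b c∈b refl = a∉b c∈b

  Distinct : BinTree n → Set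
  Distinct (tip _) = ⊤
  Distinct (bin l r) = Distinct l × Distinct r × (∀ a → a ∈ᴮ l → a ∉ᴮ r)

  firstLeaf : BinTree n → Fin n
  firstLeaf (tip a) = a
  firstLeaf (bin l _) = firstLeaf l

  firstLeaf-∈ᴮ : (b : BinTree n) → firstLeaf b ∈ᴮ b
  firstLeaf-∈ᴮ (tip _) = refl
  firstLeaf-∈ᴮ (bin l _) = inj₁ (firstLeaf-∈ᴮ l)

  ∈ᴮ⇒Occurs : {a : Fin n} (b : BinTree n) → a ∈ᴮ b → Occurs (toTree b) a
  ∈ᴮ⇒Occurs (tip a) refl = here , refl
  ∈ᴮ⇒Occurs (bin l r) (inj₁ a∈l) with ∈ᴮ⇒Occurs l a∈l
  ... | p , leaf-p = ↙ p , leaf-p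
  ∈ᴮ⇒Occurs (bin l r) (inj₂ a∈r) with ∈ᴮ⇒Occurs r a∈r
  ... | p , leaf-p = ↘ p , leaf-p

  Occurs⇒∈ᴮ : {a : Fin n} (b : BinTree n) (p : Pos (toTree b)) → sub p ≡ leaf a → a ∈ᴮ b
  Occurs⇒∈ᴮ (tip a) here refl = refl
  Occurs⇒∈ᴮ (bin l r) (↙ p) leaf-p = inj₁ (Occurs⇒∈ᴮ l p leaf-p)
  Occurs⇒∈ᴮ (bin l r) (↘ p) leaf-p = inj₂ (Occurs⇒∈ᴮ r p leaf-p)

  toTree-unique : (b : BinTree n) → Distinct b → UniqueLabels (toTree b)
  toTree-unique (tip _) _ here here _ _ _ = refl
  toTree-unique (bin l r) (dl , _ , _) (↙ p) (↙ q) a lp lq =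
    cong (λ p → ↙ p) (toTree-unique l dl p q a lp lq)
  toTree-unique (bin l r) (_ , _ , l∩r) (↙ p) (↘ q) a lp lq =
    ⊥-elim (l∩r a (Occurs⇒∈ᴮ l p lp) (Occurs⇒∈ᴮ r q lq))
  toTree-unique (bin l r) (_ , _ , l∩r) (↘ p) (↙ q) a lp lq =
    ⊥-elim (l∩r a (Occurs⇒∈ᴮ l q lq) (Occurs⇒∈ᴮ r p lp))
  toTree-unique (bin l r) (_ , dr , _) (↘ p) (↘ q) a lp lq =
    cong (λ p → ↘ p) (toTree-unique r dr p q a lp lq)

  toTree-noUnary : (b : BinTree n) (p : Pos (toTree b)) (ts : List (Tree n)) →
                   sub p ≡ node ts → length ts ≢ 1
  toTree-noUnary (tip _) here _ ()
  toTree-noUnary (bin _ _) here _ refl ()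
  toTree-noUnary (bin l _) (↙ p) = toTree-noUnary l p
  toTree-noUnary (bin _ r) (↘ p) = toTree-noUnary r p

  toTree-noEmpty : (b : BinTree n) (p : Pos (toTree b)) → sub p ≢ node []
  toTree-noEmpty (tip _) here ()
  toTree-noEmpty (bin _ _) here ()
  toTree-noEmpty (bin l _) (↙ p) = toTree-noEmpty l p
  toTree-noEmpty (bin _ r) (↘ p) = toTree-noEmpty r p

  toTree-isPhyloOn : {S : Fin n → Set} (b : BinTree n) → Distinct b →
                     (∀ a → S a → a ∈ᴮ b) → (∀ a → a ∈ᴮ b → S a) → IsPhyloOn S (toTree b)
  toTree-isPhyloOn b distinct S⊆b b⊆S =
    toTree-noUnary b , toTree-noEmpty b ,
    (λ a a∈S → ∈ᴮ⇒Occurs b (S⊆b a a∈S)) ,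
    (λ p a leaf-p → b⊆S a (Occurs⇒∈ᴮ b p leaf-p)) ,
    toTree-unique b distinct

  data Displaysᴮ : BinTree n → Fin n → Fin n → Fin n → Set where
    left  : {l r : BinTree n} {a b c : Fin n} → Displaysᴮ l a b c → Displaysᴮ (bin l r) a b c
    right : {l r : BinTree n} {a b c : Fin n} → Displaysᴮ r a b c → Displaysᴮ (bin l r) a b c
    rootˡ : {l r : BinTree n} {a b c : Fin n} → a ∈ᴮ l → b ∈ᴮ l → c ∈ᴮ r → Displaysᴮ (bin l r) a b c
    rootʳ : {l r : BinTree n} {a b c : Fin n} → a ∈ᴮ r → b ∈ᴮ r → c ∈ᴮ l → Displaysᴮ (bin l r) a b c

  Displaysᴮ⇒∈ᴮ : (b : BinTree n) {x y z : Fin n} → Displaysᴮ b x y z → x ∈ᴮ b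
  Displaysᴮ⇒∈ᴮ (bin l _) (left d) = inj₁ (Displaysᴮ⇒∈ᴮ l d)
  Displaysᴮ⇒∈ᴮ (bin _ r) (right d) = inj₂ (Displaysᴮ⇒∈ᴮ r d)
  Displaysᴮ⇒∈ᴮ (bin _ _) (rootˡ x∈l _ _) = inj₁ x∈l
  Displaysᴮ⇒∈ᴮ (bin _ _) (rootʳ x∈r _ _) = inj₂ x∈r

  Separates-child : {ts : List (Tree n)} {t : Tree n} (e : t ∈ ts) {a b c : Fin n} →
                    Separates t a b c → Separates (node ts) a b c
  Separates-child e (v , (pa , pa⪯v , la) , (pb , pb⪯v , lb) , ¬c↓ , (pc , lc)) =
    there e v , (there e pa , ⪯-there pa⪯v , la) , (there e pb , ⪯-there pb⪯v , lb) ,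
    ¬c↓′ , (there e pc , lc)
    where
    ¬c↓′ : ¬ Below (there e v) _
    ¬c↓′ (there _ q , ⪯-there q⪯v , lq) = ¬c↓ (q , q⪯v , lq)

  Displaysᴮ⇒Separates : (b : BinTree n) → Distinct b → {x y z : Fin n} →
                          Displaysᴮ b x y z → Separates (toTree b) x y z
  Displaysᴮ⇒Separates (bin l _) (dl , _) (left d) =
    Separates-child (here refl) (Displaysᴮ⇒Separates l dl d)
  Displaysᴮ⇒Separates (bin _ r) (_ , dr , _) (right d) =
    Separates-child (there (here refl)) (Displaysᴮ⇒Separates r dr d)
  Displaysᴮ⇒Separates (bin l r) (_ , _ , l∩r) (rootˡ x∈l y∈l z∈r)
    with ∈ᴮ⇒Occurs l x∈l | ∈ᴮ⇒Occurs l y∈l | ∈ᴮ⇒Occurs r z∈r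
  ... | px , lx | py , ly | pz , lz =
    ↙ here , (↙ px , ⪯-there ⪯-root , lx) ,
    (↙ py , ⪯-there ⪯-root , ly) , ¬z↓ , (↘ pz , lz)
    where
    ¬z↓ : ¬ Below (↙ here) _
    ¬z↓ (there _ q , ⪯-there _ , lq) = l∩r _ (Occurs⇒∈ᴮ l q lq) z∈r
  Displaysᴮ⇒Separates (bin l r) (_ , _ , l∩r) (rootʳ x∈r y∈r z∈l)
    with ∈ᴮ⇒Occurs r x∈r | ∈ᴮ⇒Occurs r y∈r | ∈ᴮ⇒Occurs l z∈l
  ... | px , lx | py , ly | pz , lz =
    ↘ here , (↘ px , ⪯-there ⪯-root , lx) ,
    (↘ py , ⪯-there ⪯-root , ly) , ¬z↓ , (↙ pz , lz)
    where
    ¬z↓ : ¬ Below (↘ here) _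
    ¬z↓ (there _ q , ⪯-there _ , lq) = l∩r _ z∈l (Occurs⇒∈ᴮ r q lq)

module _ {n : ℕ} where

  tripleLeaves : Triple n → List (Fin n)
  tripleLeaves r = x r ∷ y r ∷ z r ∷ []

  SameRaw-refl : (r : Triple n) → SameRaw (x r) (y r) (z r) r
  SameRaw-refl r = refl , inj₁ (refl , refl)

  SameRaw⇒∈ : {a b c : Fin n} {r : Triple n} → SameRaw a b c r →
              a ∈ tripleLeaves r × b ∈ tripleLeaves r × c ∈ tripleLeaves r
  SameRaw⇒∈ (refl , inj₁ (refl , refl)) = here refl , there (here refl) , there (there (here refl))
  SameRaw⇒∈ (refl , inj₂ (refl , refl)) = there (here refl) , here refl , there (there (here refl))

  tripleLeaves⊆LeafSet : (R′ : TripleSet n) (r : Triple n) → mem R′ (x r) (y r) (z r) →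
                         ∀ {a} → a ∈ tripleLeaves r → LeafSet R′ a
  tripleLeaves⊆LeafSet R′ r r∈R′ (here refl) = y r , z r , inj₁ r∈R′
  tripleLeaves⊆LeafSet R′ r r∈R′ (there (here refl)) = x r , z r , inj₂ (inj₁ r∈R′)
  tripleLeaves⊆LeafSet R′ r r∈R′ (there (there (here refl))) = x r , y r , inj₂ (inj₂ r∈R′)

  module _ (r₁ r₂ : Triple n) where

    pairLeaves : List (Fin n)
    pairLeaves = tripleLeaves r₁ ++ tripleLeaves r₂

    pair⇒∈ : {a b c : Fin n} → mem (pair r₁ r₂) a b c →
             a ∈ pairLeaves × b ∈ pairLeaves × c ∈ pairLeaves
    pair⇒∈ (inj₁ s) with SameRaw⇒∈ {r = r₁} s
    ... | a∈ , b∈ , c∈ = ∈-++⁺ˡ a∈ , ∈-++⁺ˡ b∈ , ∈-++⁺ˡ c∈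
    pair⇒∈ (inj₂ s) with SameRaw⇒∈ {r = r₂} s
    ... | a∈ , b∈ , c∈ = ∈ʳ a∈ , ∈ʳ b∈ , ∈ʳ c∈
      where
      ∈ʳ : {v : Fin n} → v ∈ tripleLeaves r₂ → v ∈ pairLeaves
      ∈ʳ = ∈-++⁺ʳ (tripleLeaves r₁)

    LeafSet-pair⊆ : {a : Fin n} → LeafSet (pair r₁ r₂) a → a ∈ pairLeaves
    LeafSet-pair⊆ (_ , _ , inj₁ ab|c) = proj₁ (pair⇒∈ ab|c)
    LeafSet-pair⊆ (_ , _ , inj₂ (inj₁ ba|c)) = proj₁ (proj₂ (pair⇒∈ ba|c))
    LeafSet-pair⊆ (_ , _ , inj₂ (inj₂ bc|a)) = proj₂ (proj₂ (pair⇒∈ bc|a))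

    pairLeaves⊆LeafSet : {a : Fin n} → a ∈ pairLeaves → LeafSet (pair r₁ r₂) a
    pairLeaves⊆LeafSet a∈ with ∈-++⁻ (tripleLeaves r₁) a∈
    ... | inj₁ a∈r₁ = tripleLeaves⊆LeafSet (pair r₁ r₂) r₁ (inj₁ (SameRaw-refl r₁)) a∈r₁
    ... | inj₂ a∈r₂ = tripleLeaves⊆LeafSet (pair r₁ r₂) r₂ (inj₂ (SameRaw-refl r₂)) a∈r₂

-- Strictly dense triple sets

module StrictlyDenseSet {n : ℕ} (R : TripleSet n) (dense : StrictlyDense R) where

  ⟨_,_∣_⟩ : Fin n → Fin n → Fin n → Set
  ⟨ a , b ∣ c ⟩ = mem R a b c

  mem-swap : {a b c : Fin n} → ⟨ a , b ∣ c ⟩ → ⟨ b , a ∣ c ⟩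
  mem-swap = mem-sym R

  mem-≢ab : {a b c : Fin n} → ⟨ a , b ∣ c ⟩ → a ≢ b
  mem-≢ab ab|c = proj₁ (mem-dist R ab|c)

  mem-≢ac : {a b c : Fin n} → ⟨ a , b ∣ c ⟩ → a ≢ c
  mem-≢ac ab|c = proj₁ (proj₂ (mem-dist R ab|c))

  mem-≢bc : {a b c : Fin n} → ⟨ a , b ∣ c ⟩ → b ≢ c
  mem-≢bc ab|c = proj₂ (proj₂ (mem-dist R ab|c))

  mem-¬acb : {a b c : Fin n} → ⟨ a , b ∣ c ⟩ → ¬ ⟨ a , c ∣ b ⟩
  mem-¬acb ab|c ac|b =
    proj₁ (proj₂ (dense _ _ _ (mem-≢ab ab|c) (mem-≢ac ab|c) (mem-≢bc ab|c))) (ab|c , ac|b)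

  mem-¬bca : {a b c : Fin n} → ⟨ a , b ∣ c ⟩ → ¬ ⟨ b , c ∣ a ⟩
  mem-¬bca ab|c bc|a =
    proj₁ (proj₂ (proj₂ (dense _ _ _ (mem-≢ab ab|c) (mem-≢ac ab|c) (mem-≢bc ab|c)))) (ab|c , bc|a)

  tripleOf : {a b c : Fin n} → ⟨ a , b ∣ c ⟩ → Triple n
  tripleOf {a} {b} {c} ab|c = triple a b c (mem-≢ab ab|c) (mem-≢ac ab|c) (mem-≢bc ab|c)

  DisplaysRestriction : Tree n → Set
  DisplaysRestriction t = ∀ {a b c} → Occurs t a → Occurs t b → Occurs t c →
                          ⟨ a , b ∣ c ⟩ → Separates t a b c

  -- Of the three triples on {a, b, c} exactly one is in R, and t separates at most one.
  separates⇒mem : {t : Tree n} → UniqueLabels t → DisplaysRestriction t →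
                  {a b c : Fin n} → Separates t a b c → a ≢ b → ⟨ a , b ∣ c ⟩
  separates⇒mem unique displays ab|c@(_ , a↓ , b↓ , _ , c∈) a≢b
    with proj₁ (dense _ _ _ a≢b (Separates-≢ˡ ab|c) (Separates-≢ʳ ab|c))
  ... | inj₁ abc = abc
  ... | inj₂ (inj₁ acb) =
    ⊥-elim (Separates-excl unique ab|c (displays (Below⇒Occurs a↓) c∈ (Below⇒Occurs b↓) acb))
  ... | inj₂ (inj₂ bca) =
    ⊥-elim (Separates-excl unique (Separates-sym ab|c)
                           (displays (Below⇒Occurs b↓) c∈ (Below⇒Occurs a↓) bca))

  DisplaysRestrictionᴮ : BinTree n → Set
  DisplaysRestrictionᴮ b = ∀ {x y z} → x ∈ᴮ b → y ∈ᴮ b → z ∈ᴮ b → ⟨ x , y ∣ z ⟩ → Displaysᴮ b x y z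

  DisplaysRestrictionᴮ⇒DisplaysRestriction : (b : BinTree n) → Distinct b →
    DisplaysRestrictionᴮ b → DisplaysRestriction (toTree b)
  DisplaysRestrictionᴮ⇒DisplaysRestriction b distinct displays (p , lp) (q , lq) (s , ls) xy|z =
    Displaysᴮ⇒Separates b distinct
      (displays (Occurs⇒∈ᴮ b p lp) (Occurs⇒∈ᴮ b q lq) (Occurs⇒∈ᴮ b s ls) xy|z)

  Displaysᴮ⇒mem : (b : BinTree n) → Distinct b → DisplaysRestrictionᴮ b →
                  {x y z : Fin n} → Displaysᴮ b x y z → x ≢ y → ⟨ x , y ∣ z ⟩
  Displaysᴮ⇒mem b distinct displays d =
    separates⇒mem (toTree-unique b distinct)
                  (DisplaysRestrictionᴮ⇒DisplaysRestriction b distinct displays)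
                  (Displaysᴮ⇒Separates b distinct d)

  module _ {P Q : BinTree n} (distinct : Distinct (bin P Q))
           (displays : DisplaysRestrictionᴮ (bin P Q)) where

    root-tripleˡ : {x y z : Fin n} → x ∈ᴮ P → y ∈ᴮ P → z ∈ᴮ Q → x ≢ y → ⟨ x , y ∣ z ⟩
    root-tripleˡ x∈P y∈P z∈Q =
      Displaysᴮ⇒mem (bin P Q) distinct displays (rootˡ x∈P y∈P z∈Q)

    root-tripleʳ : {x y z : Fin n} → x ∈ᴮ Q → y ∈ᴮ Q → z ∈ᴮ P → x ≢ y → ⟨ x , y ∣ z ⟩
    root-tripleʳ x∈Q y∈Q z∈P =
      Displaysᴮ⇒mem (bin P Q) distinct displays (rootʳ x∈Q y∈Q z∈P)

  ∈ᴮ-swap : {P Q : BinTree n} {a : Fin n} → a ∈ᴮ bin Q P → a ∈ᴮ bin P Q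
  ∈ᴮ-swap (inj₁ a∈Q) = inj₂ a∈Q
  ∈ᴮ-swap (inj₂ a∈P) = inj₁ a∈P

  Distinct-swap : {P Q : BinTree n} → Distinct (bin P Q) → Distinct (bin Q P)
  Distinct-swap (dP , dQ , P∩Q) = dQ , dP , λ a a∈Q a∈P → P∩Q a a∈P a∈Q

  DisplaysRestrictionᴮ-swap : {P Q : BinTree n} →
    DisplaysRestrictionᴮ (bin P Q) → DisplaysRestrictionᴮ (bin Q P)
  DisplaysRestrictionᴮ-swap displays x∈ y∈ z∈ xy|z =
    swap-displays (displays (∈ᴮ-swap x∈) (∈ᴮ-swap y∈) (∈ᴮ-swap z∈) xy|z)
    where
    swap-displays : {P Q : BinTree n} {a b c : Fin n} →
                    Displaysᴮ (bin P Q) a b c → Displaysᴮ (bin Q P) a b c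
    swap-displays (left d) = right d
    swap-displays (right d) = left d
    swap-displays (rootˡ a∈ b∈ c∈) = rootʳ a∈ b∈ c∈
    swap-displays (rootʳ a∈ b∈ c∈) = rootˡ a∈ b∈ c∈

  DisplaysRestrictionᴮ-left : {P Q : BinTree n} → Distinct (bin P Q) →
    DisplaysRestrictionᴮ (bin P Q) → DisplaysRestrictionᴮ P
  DisplaysRestrictionᴮ-left {Q = Q} (_ , _ , P∩Q) displays x∈P y∈P z∈P xy|z
    with displays (inj₁ x∈P) (inj₁ y∈P) (inj₁ z∈P) xy|z
  ... | left d = d
  ... | right d = ⊥-elim (P∩Q _ x∈P (Displaysᴮ⇒∈ᴮ Q d))
  ... | rootˡ _ _ z∈Q = ⊥-elim (P∩Q _ z∈P z∈Q)
  ... | rootʳ x∈Q _ _ = ⊥-elim (P∩Q _ x∈P x∈Q)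

  DisplaysRestrictionᴮ-right : {P Q : BinTree n} → Distinct (bin P Q) →
    DisplaysRestrictionᴮ (bin P Q) → DisplaysRestrictionᴮ Q
  DisplaysRestrictionᴮ-right distinct displays =
    DisplaysRestrictionᴮ-left (Distinct-swap distinct) (DisplaysRestrictionᴮ-swap displays)

  -- Inserting leaves

  record Insertion (a : Fin n) (b : BinTree n) : Set where
    field
      tree     : BinTree n
      distinct : Distinct tree
      displays : DisplaysRestrictionᴮ tree
      leaves⊆  : ∀ {x} → x ∈ᴮ tree → x ≡ a ⊎ x ∈ᴮ b
      ⊆leaves  : ∀ {x} → x ≡ a ⊎ x ∈ᴮ b → x ∈ᴮ tree

  record Built (xs : List (Fin n)) : Set where
    field
      tree     : BinTree n
      distinct : Distinct tree
      displays : DisplaysRestrictionᴮ tree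
      leaves⊆  : ∀ {x} → x ∈ᴮ tree → x ∈ xs
      ⊆leaves  : ∀ {x} → x ∈ xs → x ∈ᴮ tree

  module Insert (closed : InferenceClosed (mem R)) where
    open InferenceClosed closed

    module _ {P Q : BinTree n} (distinct : Distinct (bin P Q))
             (displays : DisplaysRestrictionᴮ (bin P Q)) {a : Fin n} (a∉ : a ∉ᴮ bin P Q) where

      module Outgroup {l r : Fin n} (l∈P : l ∈ᴮ P) (r∈Q : r ∈ᴮ Q) (lr|a : ⟨ l , r ∣ a ⟩) where

        yr|a : {y : Fin n} → y ∈ᴮ P → ⟨ y , r ∣ a ⟩
        yr|a {y} y∈P with y ≟ᶠ l
        ... | yes refl = lr|a
        ... | no y≢l = ab|c,ac|d⇒bc|d (root-tripleˡ distinct displays l∈P y∈P r∈Q (≢-sym y≢l))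
                                      lr|a (∉ᴮ⇒≢ a∉ (inj₁ y∈P))

        yz|a-across : {y z : Fin n} → y ∈ᴮ P → z ∈ᴮ Q → ⟨ y , z ∣ a ⟩
        yz|a-across {z = z} y∈P z∈Q with z ≟ᶠ r
        ... | yes refl = yr|a y∈P
        ... | no z≢r = mem-swap (ab|c,ac|d⇒bc|d
                        (root-tripleʳ distinct displays r∈Q z∈Q y∈P (≢-sym z≢r))
                        (mem-swap (yr|a y∈P)) (∉ᴮ⇒≢ a∉ (inj₂ z∈Q)))

        yz|a-within : {y z : Fin n} → y ∈ᴮ P → z ∈ᴮ P → y ≢ z → ⟨ y , z ∣ a ⟩
        yz|a-within y∈P z∈P y≢z = ab|c,ac|d⇒ab|d (root-tripleˡ distinct displays y∈P z∈P r∈Q y≢z)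
                                                (yr|a y∈P) (∉ᴮ⇒≢ a∉ (inj₁ z∈P))

      -- P′ is P with a inserted.
      module JoinLeft {l r : Fin n} (l∈P : l ∈ᴮ P) (r∈Q : r ∈ᴮ Q) (la|r : ⟨ l , a ∣ r ⟩)
                      (P′ : BinTree n) (P′⊆ : ∀ {x} → x ∈ᴮ P′ → x ≡ a ⊎ x ∈ᴮ P) where

        al|y : {y : Fin n} → y ∈ᴮ Q → ⟨ a , l ∣ y ⟩
        al|y {y} y∈Q with y ≟ᶠ r
        ... | yes refl = mem-swap la|r
        ... | no y≢r = ab|c,cd|b⇒ab|d (mem-swap la|r)
                         (root-tripleʳ distinct displays r∈Q y∈Q l∈P (≢-sym y≢r))
                         (≢-sym (∉ᴮ⇒≢ a∉ (inj₂ y∈Q)))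

        aw|y : {w y : Fin n} → w ∈ᴮ P → y ∈ᴮ Q → ⟨ a , w ∣ y ⟩
        aw|y {w} w∈P y∈Q with w ≟ᶠ l
        ... | yes refl = al|y y∈Q
        ... | no w≢l = mem-swap (ab|c,ad|c⇒bd|c
                         (root-tripleˡ distinct displays l∈P w∈P y∈Q (≢-sym w≢l))
                         (mem-swap (al|y y∈Q)) (∉ᴮ⇒≢ a∉ (inj₁ w∈P)))

        yz|a : {y z : Fin n} → y ∈ᴮ Q → z ∈ᴮ Q → y ≢ z → ⟨ y , z ∣ a ⟩
        yz|a y∈Q z∈Q y≢z = mem-swap (ab|c,cd|b⇒ab|d
                             (root-tripleʳ distinct displays z∈Q y∈Q l∈P (≢-sym y≢z))
                             (mem-swap (al|y y∈Q)) (∉ᴮ⇒≢ a∉ (inj₂ z∈Q)))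

        xz|y : {x z y : Fin n} → x ∈ᴮ P′ → z ∈ᴮ P′ → y ∈ᴮ Q → x ≢ z → ⟨ x , z ∣ y ⟩
        xz|y x∈ z∈ y∈Q x≢z with P′⊆ x∈ | P′⊆ z∈
        ... | inj₁ refl | inj₁ refl = ⊥-elim (x≢z refl)
        ... | inj₁ refl | inj₂ z∈P = aw|y z∈P y∈Q
        ... | inj₂ x∈P | inj₁ refl = mem-swap (aw|y x∈P y∈Q)
        ... | inj₂ x∈P | inj₂ z∈P = root-tripleˡ distinct displays x∈P z∈P y∈Q x≢z

        yz|x : {x y z : Fin n} → x ∈ᴮ P′ → y ∈ᴮ Q → z ∈ᴮ Q → y ≢ z → ⟨ y , z ∣ x ⟩
        yz|x x∈ y∈Q z∈Q y≢z with P′⊆ x∈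
        ... | inj₁ refl = yz|a y∈Q z∈Q y≢z
        ... | inj₂ x∈P = root-tripleʳ distinct displays y∈Q z∈Q x∈P y≢z

        ¬straddling : {x y z : Fin n} → x ∈ᴮ P′ → y ∈ᴮ Q → z ∈ᴮ bin P′ Q → ¬ ⟨ x , y ∣ z ⟩
        ¬straddling x∈ y∈Q (inj₁ z∈) xy|z = mem-¬acb xy|z (xz|y x∈ z∈ y∈Q (mem-≢ac xy|z))
        ¬straddling x∈ y∈Q (inj₂ z∈Q) xy|z = mem-¬bca xy|z (yz|x x∈ y∈Q z∈Q (mem-≢bc xy|z))

        joined-distinct : Distinct P′ → Distinct (bin P′ Q)
        joined-distinct dP′ = dP′ , proj₁ (proj₂ distinct) , P′∩Q
          where
          P′∩Q : ∀ x → x ∈ᴮ P′ → x ∉ᴮ Q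
          P′∩Q x x∈ x∈Q with P′⊆ x∈
          ... | inj₁ refl = a∉ (inj₂ x∈Q)
          ... | inj₂ x∈P = proj₂ (proj₂ distinct) x x∈P x∈Q

        joined-displays : DisplaysRestrictionᴮ P′ → DisplaysRestrictionᴮ (bin P′ Q)
        joined-displays dP′ (inj₁ x∈) (inj₁ y∈) (inj₁ z∈) xy|z = left (dP′ x∈ y∈ z∈ xy|z)
        joined-displays dP′ (inj₁ x∈) (inj₁ y∈) (inj₂ z∈Q) xy|z = rootˡ x∈ y∈ z∈Q
        joined-displays dP′ (inj₁ x∈) (inj₂ y∈Q) z∈ xy|z = ⊥-elim (¬straddling x∈ y∈Q z∈ xy|z)
        joined-displays dP′ (inj₂ x∈Q) (inj₁ y∈) z∈ xy|z =
          ⊥-elim (¬straddling y∈ x∈Q z∈ (mem-swap xy|z))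
        joined-displays dP′ (inj₂ x∈Q) (inj₂ y∈Q) (inj₁ z∈) xy|z =
          rootʳ x∈Q y∈Q z∈
        joined-displays dP′ (inj₂ x∈Q) (inj₂ y∈Q) (inj₂ z∈Q) xy|z =
          right (DisplaysRestrictionᴮ-right distinct displays x∈Q y∈Q z∈Q xy|z)

    graft : {P Q : BinTree n} → Distinct (bin P Q) → DisplaysRestrictionᴮ (bin P Q) →
            {a : Fin n} → a ∉ᴮ bin P Q → {l r : Fin n} → l ∈ᴮ P → r ∈ᴮ Q → ⟨ l , r ∣ a ⟩ →
            Insertion a (bin P Q)
    graft {P} {Q} distinct displays {a} a∉ l∈P r∈Q lr|a = record
      { tree     = bin (bin P Q) (tip a)
      ; distinct = distinct , tt , λ { x x∈ refl → a∉ x∈ }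
      ; displays = grafted-displays
      ; leaves⊆  = λ { (inj₁ x∈) → inj₂ x∈ ; (inj₂ x≡a) → inj₁ x≡a }
      ; ⊆leaves  = λ { (inj₁ x≡a) → inj₂ x≡a ; (inj₂ x∈) → inj₁ x∈ }
      }
      where
      module Left = Outgroup distinct displays a∉ l∈P r∈Q lr|a
      module Right = Outgroup (Distinct-swap distinct) (DisplaysRestrictionᴮ-swap displays)
                              (a∉ ∘ ∈ᴮ-swap) r∈Q l∈P (mem-swap lr|a)

      yz|a : {y z : Fin n} → y ∈ᴮ bin P Q → z ∈ᴮ bin P Q → y ≢ z → ⟨ y , z ∣ a ⟩
      yz|a (inj₁ y∈P) (inj₁ z∈P) y≢z = Left.yz|a-within y∈P z∈P y≢z
      yz|a (inj₁ y∈P) (inj₂ z∈Q) _ = Left.yz|a-across y∈P z∈Q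
      yz|a (inj₂ y∈Q) (inj₁ z∈P) _ = mem-swap (Left.yz|a-across z∈P y∈Q)
      yz|a (inj₂ y∈Q) (inj₂ z∈Q) y≢z = Right.yz|a-within y∈Q z∈Q y≢z

      grafted-displays : DisplaysRestrictionᴮ (bin (bin P Q) (tip a))
      grafted-displays (inj₂ refl) (inj₂ refl) _ xy|z = ⊥-elim (mem-≢ab xy|z refl)
      grafted-displays (inj₂ refl) (inj₁ _) (inj₂ refl) xy|z = ⊥-elim (mem-≢ac xy|z refl)
      grafted-displays (inj₂ refl) (inj₁ y∈) (inj₁ z∈) ay|z =
        ⊥-elim (mem-¬bca ay|z (yz|a y∈ z∈ (mem-≢bc ay|z)))
      grafted-displays (inj₁ _) (inj₂ refl) (inj₂ refl) xy|z = ⊥-elim (mem-≢bc xy|z refl)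
      grafted-displays (inj₁ x∈) (inj₂ refl) (inj₁ z∈) xa|z =
        ⊥-elim (mem-¬bca (mem-swap xa|z) (yz|a x∈ z∈ (mem-≢ac xa|z)))
      grafted-displays (inj₁ x∈) (inj₁ y∈) (inj₂ refl) _ = rootˡ x∈ y∈ refl
      grafted-displays (inj₁ x∈) (inj₁ y∈) (inj₁ z∈) xy|z = left (displays x∈ y∈ z∈ xy|z)

    join : {P Q : BinTree n} → Distinct (bin P Q) → DisplaysRestrictionᴮ (bin P Q) →
           {a : Fin n} → a ∉ᴮ bin P Q → {l r : Fin n} → l ∈ᴮ P → r ∈ᴮ Q → ⟨ l , a ∣ r ⟩ →
           Insertion a P → Insertion a (bin P Q)
    join {P} {Q} distinct displays {a} a∉ l∈P r∈Q la|r I = record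
      { tree     = bin I.tree Q
      ; distinct = joined-distinct I.distinct
      ; displays = joined-displays I.displays
      ; leaves⊆  = λ { (inj₁ x∈) → Sum.map₂ inj₁ (I.leaves⊆ x∈) ; (inj₂ x∈Q) → inj₂ (inj₂ x∈Q) }
      ; ⊆leaves  = λ { (inj₁ x≡a) → inj₁ (I.⊆leaves (inj₁ x≡a))
                     ; (inj₂ (inj₁ x∈P)) → inj₁ (I.⊆leaves (inj₂ x∈P))
                     ; (inj₂ (inj₂ x∈Q)) → inj₂ x∈Q }
      }
      where
      module I = Insertion I
      open JoinLeft distinct displays a∉ l∈P r∈Q la|r I.tree I.leaves⊆

    Insertion-swap : {P Q : BinTree n} {a : Fin n} → Insertion a (bin Q P) → Insertion a (bin P Q)
    Insertion-swap I = record
      { tree     = I.tree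
      ; distinct = I.distinct
      ; displays = I.displays
      ; leaves⊆  = Sum.map₂ ∈ᴮ-swap ∘ I.leaves⊆
      ; ⊆leaves  = I.⊆leaves ∘ Sum.map₂ ∈ᴮ-swap
      }
      where module I = Insertion I

    insert : (a : Fin n) (b : BinTree n) → Distinct b → a ∉ᴮ b → DisplaysRestrictionᴮ b →
             Insertion a b
    insert a (tip c) _ a∉ _ = record
      { tree     = bin (tip c) (tip a)
      ; distinct = tt , tt , λ { _ refl refl → a∉ refl }
      ; displays = λ x∈ y∈ z∈ xy|z → ⊥-elim (no-triple x∈ y∈ z∈ xy|z)
      ; leaves⊆  = λ { (inj₁ x≡c) → inj₂ x≡c ; (inj₂ x≡a) → inj₁ x≡a }
      ; ⊆leaves  = λ { (inj₁ x≡a) → inj₂ x≡a ; (inj₂ x≡c) → inj₁ x≡c }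
      }
      where
      no-triple : {x y z : Fin n} → x ∈ᴮ bin (tip c) (tip a) → y ∈ᴮ bin (tip c) (tip a) →
                  z ∈ᴮ bin (tip c) (tip a) → ¬ ⟨ x , y ∣ z ⟩
      no-triple (inj₁ refl) (inj₁ refl) _ xy|z = mem-≢ab xy|z refl
      no-triple (inj₂ refl) (inj₂ refl) _ xy|z = mem-≢ab xy|z refl
      no-triple (inj₁ refl) _ (inj₁ refl) xy|z = mem-≢ac xy|z refl
      no-triple (inj₂ refl) _ (inj₂ refl) xy|z = mem-≢ac xy|z refl
      no-triple _ (inj₁ refl) (inj₁ refl) xy|z = mem-≢bc xy|z refl
      no-triple _ (inj₂ refl) (inj₂ refl) xy|z = mem-≢bc xy|z refl
    insert a (bin P Q) distinct@(dP , dQ , P∩Q) a∉ displays =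
      place (proj₁ (dense p q a p≢q (∉ᴮ⇒≢ a∉ (inj₁ p∈P)) (∉ᴮ⇒≢ a∉ (inj₂ q∈Q))))
      where
      p q : Fin n
      p = firstLeaf P
      q = firstLeaf Q
      p∈P : p ∈ᴮ P
      p∈P = firstLeaf-∈ᴮ P
      q∈Q : q ∈ᴮ Q
      q∈Q = firstLeaf-∈ᴮ Q
      p≢q : p ≢ q
      p≢q p≡q = P∩Q p p∈P (subst (_∈ᴮ Q) (sym p≡q) q∈Q)

      place : ⟨ p , q ∣ a ⟩ ⊎ ⟨ p , a ∣ q ⟩ ⊎ ⟨ q , a ∣ p ⟩ → Insertion a (bin P Q)
      place (inj₁ pq|a) = graft distinct displays a∉ p∈P q∈Q pq|a
      place (inj₂ (inj₁ pa|q)) =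
        join distinct displays a∉ p∈P q∈Q pa|q
             (insert a P dP (a∉ ∘ inj₁) (DisplaysRestrictionᴮ-left distinct displays))
      place (inj₂ (inj₂ qa|p)) =
        Insertion-swap (join (Distinct-swap distinct) (DisplaysRestrictionᴮ-swap displays)
                             (a∉ ∘ ∈ᴮ-swap) q∈Q p∈P qa|p
                             (insert a Q dQ (a∉ ∘ inj₂)
                                     (DisplaysRestrictionᴮ-right distinct displays)))

    add-leaf : (a : Fin n) {xs : List (Fin n)} → Built xs → Built (a ∷ xs)
    add-leaf a B with a ∈ᴮ? Built.tree B
    ... | yes a∈ = record
      { tree     = B.tree
      ; distinct = B.distinct
      ; displays = B.displays
      ; leaves⊆  = there ∘ B.leaves⊆
      ; ⊆leaves  = λ { (here refl) → a∈ ; (there x∈) → B.⊆leaves x∈ }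
      }
      where module B = Built B
    ... | no a∉ = record
      { tree     = I.tree
      ; distinct = I.distinct
      ; displays = I.displays
      ; leaves⊆  = Any.fromSum ∘ Sum.map₂ B.leaves⊆ ∘ I.leaves⊆
      ; ⊆leaves  = I.⊆leaves ∘ Sum.map₂ B.⊆leaves ∘ Any.toSum
      }
      where
      module B = Built B
      module I = Insertion (insert a B.tree B.distinct a∉ B.displays)

    build : (x₀ : Fin n) (xs : List (Fin n)) → Built (x₀ ∷ xs)
    build x₀ [] = record
      { tree     = tip x₀
      ; distinct = tt
      ; displays = λ { refl refl _ xy|z → ⊥-elim (mem-≢ab xy|z refl) }
      ; leaves⊆  = λ { refl → here refl }
      ; ⊆leaves  = λ { (here refl) → refl }
      }
    build x₀ (x₁ ∷ xs) = add-leaf x₀ (build x₁ xs)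

  module _ {xs : List (Fin n)} (B : Built xs) (R′ : TripleSet n) where
    open Built B

    Built-isPhyloOn : (∀ {a} → LeafSet R′ a → a ∈ xs) → (∀ {a} → a ∈ xs → LeafSet R′ a) →
                      IsPhyloOn (LeafSet R′) (toTree tree)
    Built-isPhyloOn R′⊆xs xs⊆R′ =
      toTree-isPhyloOn tree distinct (λ _ → ⊆leaves ∘ R′⊆xs) (λ _ → xs⊆R′ ∘ leaves⊆)

    Built-displays : (∀ {a b c} → mem R′ a b c → ⟨ a , b ∣ c ⟩) → (∀ {a} → LeafSet R′ a → a ∈ xs) →
                     DisplaysAll (toTree tree) R′
    Built-displays R′⊆R R′⊆xs t t∈R′ =
      Separates⇒Displays t (Displaysᴮ⇒Separates tree distinct
        (displays (⊆leaves (R′⊆xs (y t , z t , inj₁ t∈R′)))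
                  (⊆leaves (R′⊆xs (x t , z t , inj₂ (inj₁ t∈R′))))
                  (⊆leaves (R′⊆xs (x t , y t , inj₂ (inj₂ t∈R′))))
                  (R′⊆R t∈R′)))

  -- Consistency and the closure condition

  SameRaw⇒mem : {a b c : Fin n} (r : Triple n) → SameRaw a b c r → r ∈R R → ⟨ a , b ∣ c ⟩
  SameRaw⇒mem r (refl , inj₁ (refl , refl)) r∈R = r∈R
  SameRaw⇒mem r (refl , inj₂ (refl , refl)) r∈R = mem-swap r∈R

  ClosureCondition : Set
  ClosureCondition = ∀ (r₁ r₂ : Triple n) → r₁ ∈R R → r₂ ∈R R → ¬ (r₁ ≈T r₂) →
                     ∀ (t : Triple n) → Cl (pair r₁ r₂) t → t ∈R R

  consistent⇒closed : Consistent R → InferenceClosed (mem R)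
  consistent⇒closed (T , phylo , displays) = record
    { ab|c,ac|d⇒bc|d = λ ab|c ac|d b≢d →
        fromSeparates (S.ab|c,ac|d⇒bc|d (toSeparates ab|c) (toSeparates ac|d) b≢d) (mem-≢bc ab|c)
    ; ab|c,ac|d⇒ab|d = λ ab|c ac|d b≢d →
        fromSeparates (S.ab|c,ac|d⇒ab|d (toSeparates ab|c) (toSeparates ac|d) b≢d) (mem-≢ab ab|c)
    ; ab|c,cd|b⇒ab|d = λ ab|c cd|b a≢d →
        fromSeparates (S.ab|c,cd|b⇒ab|d (toSeparates ab|c) (toSeparates cd|b) a≢d) (mem-≢ab ab|c)
    ; ab|c,ad|c⇒bd|c = λ ab|c ad|c b≢d →
        fromSeparates (S.ab|c,ad|c⇒bd|c (toSeparates ab|c) (toSeparates ad|c) b≢d) b≢d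
    }
    where
    unique : UniqueLabels T
    unique = IsPhyloOn⇒UniqueLabels phylo
    module S = InferenceClosed (Separates-closed unique)

    toSeparates : {a b c : Fin n} → ⟨ a , b ∣ c ⟩ → Separates T a b c
    toSeparates ab|c = Displays⇒Separates unique (tripleOf ab|c) (displays (tripleOf ab|c) ab|c)

    fromSeparates : {a b c : Fin n} → Separates T a b c → a ≢ b → ⟨ a , b ∣ c ⟩
    fromSeparates = separates⇒mem unique (λ _ _ _ → toSeparates)

  module _ (condition : ClosureCondition) where

    closure-of-two : {a b c a′ b′ c′ : Fin n} (ab|c : ⟨ a , b ∣ c ⟩) (a′b′|c′ : ⟨ a′ , b′ ∣ c′ ⟩) →
      ¬ (tripleOf ab|c ≈T tripleOf a′b′|c′) → (t : Triple n) →
      (∀ {T : Tree n} → UniqueLabels T → Separates T a b c → Separates T a′ b′ c′ →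
                        Separates T (x t) (y t) (z t)) →
      t ∈R R
    closure-of-two ab|c a′b′|c′ r₁≉r₂ t infer =
      condition r₁ r₂ ab|c a′b′|c′ r₁≉r₂ t t∈cl
      where
      r₁ r₂ : Triple n
      r₁ = tripleOf ab|c
      r₂ = tripleOf a′b′|c′
      t∈cl : Cl (pair r₁ r₂) t
      t∈cl T phylo displays = Separates⇒Displays t (infer unique
        (Displays⇒Separates unique r₁ (displays r₁ (inj₁ (SameRaw-refl r₁))))
        (Displays⇒Separates unique r₂ (displays r₂ (inj₂ (SameRaw-refl r₂)))))
        where
        unique : UniqueLabels T
        unique = IsPhyloOn⇒UniqueLabels phylo

    closure-condition⇒closed : InferenceClosed (mem R)
    closure-condition⇒closed = record
      { ab|c,ac|d⇒bc|d = λ ab|c ac|d b≢d →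
          closure-of-two ab|c ac|d (λ e → mem-≢bc ac|d (proj₁ e))
            (triple _ _ _ (mem-≢bc ab|c) b≢d (mem-≢bc ac|d))
            (λ unique s₁ s₂ → InferenceClosed.ab|c,ac|d⇒bc|d (Separates-closed unique) s₁ s₂ b≢d)
      ; ab|c,ac|d⇒ab|d = λ ab|c ac|d b≢d →
          closure-of-two ab|c ac|d (λ e → mem-≢bc ac|d (proj₁ e))
            (triple _ _ _ (mem-≢ab ab|c) (mem-≢ac ac|d) b≢d)
            (λ unique s₁ s₂ → InferenceClosed.ab|c,ac|d⇒ab|d (Separates-closed unique) s₁ s₂ b≢d)
      ; ab|c,cd|b⇒ab|d = λ ab|c cd|b a≢d →
          closure-of-two ab|c cd|b (λ e → mem-≢bc ab|c (sym (proj₁ e)))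
            (triple _ _ _ (mem-≢ab ab|c) a≢d (≢-sym (mem-≢bc cd|b)))
            (λ unique s₁ s₂ → InferenceClosed.ab|c,cd|b⇒ab|d (Separates-closed unique) s₁ s₂ a≢d)
      ; ab|c,ad|c⇒bd|c = λ ab|c ad|c b≢d →
          closure-of-two ab|c ad|c (distinct-premises ad|c b≢d)
            (triple _ _ _ b≢d (mem-≢bc ab|c) (mem-≢bc ad|c))
            (λ unique s₁ s₂ → InferenceClosed.ab|c,ad|c⇒bd|c (Separates-closed unique) s₁ s₂ b≢d)
      }
      where
      distinct-premises : {a b c d : Fin n} (ad|c : ⟨ a , d ∣ c ⟩) → b ≢ d →
                          ¬ SameRaw a b c (tripleOf ad|c)
      distinct-premises _ b≢d (_ , inj₁ (_ , b≡d)) = b≢d b≡d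
      distinct-premises ad|c _ (_ , inj₂ (a≡d , _)) = mem-≢ab ad|c a≡d

  module _ (closed : InferenceClosed (mem R)) where
    open Insert closed

    closed⇒closure-condition : ClosureCondition
    closed⇒closure-condition r₁ r₂ r₁∈R r₂∈R _ t t∈cl =
      separates⇒mem unique (DisplaysRestrictionᴮ⇒DisplaysRestriction B.tree B.distinct B.displays)
        (Displays⇒Separates unique t (t∈cl (toTree B.tree) phylo displays)) (x≢y t)
      where
      B : Built (pairLeaves r₁ r₂)
      B = build (x r₁) (y r₁ ∷ z r₁ ∷ tripleLeaves r₂)
      module B = Built B
      unique : UniqueLabels (toTree B.tree)
      unique = toTree-unique B.tree B.distinct
      pair⊆R : {a b c : Fin n} → mem (pair r₁ r₂) a b c → ⟨ a , b ∣ c ⟩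
      pair⊆R (inj₁ s) = SameRaw⇒mem r₁ s r₁∈R
      pair⊆R (inj₂ s) = SameRaw⇒mem r₂ s r₂∈R
      phylo : IsPhyloOn (LeafSet (pair r₁ r₂)) (toTree B.tree)
      phylo = Built-isPhyloOn B (pair r₁ r₂) (LeafSet-pair⊆ r₁ r₂) (pairLeaves⊆LeafSet r₁ r₂)
      displays : DisplaysAll (toTree B.tree) (pair r₁ r₂)
      displays = Built-displays B (pair r₁ r₂) pair⊆R (LeafSet-pair⊆ r₁ r₂)

    -- build needs a first leaf x₀; it occurs again in allFin n.
    closed⇒consistent : Fin n → (∀ a → LeafSet R a) → Consistent R
    closed⇒consistent x₀ everyLeaf =
      toTree B.tree ,
      Built-isPhyloOn B R (λ {a} _ → there (∈-allFin a)) (λ {a} _ → everyLeaf a) ,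
      Built-displays B R (λ ab|c → ab|c) (λ {a} _ → there (∈-allFin a))
      where
      B : Built (x₀ ∷ allFin n)
      B = build x₀ (allFin n)
      module B = Built B

two-others : {k : ℕ} (a : Fin (3 + k)) → ∃[ b ] ∃[ c ] (a ≢ b × a ≢ c × b ≢ c)
two-others zero = suc zero , suc (suc zero) , (λ ()) , (λ ()) , (λ ())
two-others (suc zero) = zero , suc (suc zero) , (λ ()) , (λ ()) , (λ ())
two-others (suc (suc zero)) = zero , suc zero , (λ ()) , (λ ()) , (λ ())
two-others (suc (suc (suc _))) = zero , suc zero , (λ ()) , (λ ()) , (λ ())

StrictlyDense⇒LeafSet : {k : ℕ} (R : TripleSet (3 + k)) → StrictlyDense R → ∀ a → LeafSet R a
StrictlyDense⇒LeafSet R dense a with two-others a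
... | b , c , a≢b , a≢c , b≢c with proj₁ (dense a b c a≢b a≢c b≢c)
...   | inj₁ ab|c = b , c , inj₁ ab|c
...   | inj₂ (inj₁ ac|b) = c , b , inj₁ ac|b
...   | inj₂ (inj₂ bc|a) = b , c , inj₂ (inj₂ bc|a)

theorem1 : ∀ (n : ℕ) → 3 ≤ n → (R : TripleSet n) → StrictlyDense R →
    Consistent R ⇔
      (∀ (r₁ r₂ : Triple n) → r₁ ∈R R → r₂ ∈R R → ¬ (r₁ ≈T r₂) →
        ∀ (t : Triple n) → Cl (pair r₁ r₂) t → t ∈R R)
theorem1 (suc (suc (suc k))) (s≤s (s≤s (s≤s _))) R dense =
  mk⇔ (closed⇒closure-condition ∘ consistent⇒closed)
      (λ condition → closed⇒consistent (closure-condition⇒closed condition)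
                                       zero (StrictlyDense⇒LeafSet R dense))
  where open StrictlyDenseSet R dense
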